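{- Assume the Diagonal Conjecture (DC) holds. Then for every integer $k \geq 3$ and every integer $r \geq 1$, $$R_{2r}(k) - 1 \geq \bigl(R_r(k-1) - 1\bigr)\bigl(R_r(k+1) - 1\bigr).$$
   Context: For integers $k_1,\dots,k_m \ge 2$, the multicolor Ramsey number $R(k_1,\dots,k_m)$ is the least $n$ such that every coloring of the edges of the complete graph $K_n$ with $m$ colors contains, for some $i$, a complete subgraph $K_{k_i}$ all of whose edges have color $i$. This number is symmetric in its arguments. $R_m(k)$ denotes $R(k,\dots,k)$ with $m$ arguments equal to $k$. DC (the Diagonal Conjecture, in multicolor form) is the assertion: for all integers $3 \le s \le t$ and any integers $k_3,\dots,k_m \ge 2$ (with $m\ge 2$), $R(s,t,k_3,\dots,k_m) \ge R(s-1,t+1,k_3,\dots,k_m)$; for two colors this reads $R(s,t)\ge R(s-1,t+1)$ for $3\le s\le t$. -}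

module Defs where

open import Data.Nat using (ℕ; zero; suc; _≤_; _∸_; _*_; _+_; pred)
open import Data.Fin using (Fin)
open import Data.List using (List; _∷_; length; lookup; replicate)
open import Data.List.Relation.Unary.All using (All)
open import Data.Product using (Σ; _×_; ∃; ∃-syntax)
open import Relation.Binary.PropositionalEquality using (_≡_; _≢_)
open import Function.Definitions using (Injective)

-- Edges are unordered pairs, so the colouring is a symmetric function;
-- its values on the diagonal (x , x) are irrelevant (never inspected).
Colouring : ℕ → List ℕ → Set
Colouring n ks = Fin n → Fin n → Fin (length ks)

SymmetricColouring : {n : ℕ} {ks : List ℕ} → Colouring n ks → Set
SymmetricColouring c = ∀ x y → c x y ≡ c y x

MonoClique : {n : ℕ} {ks : List ℕ} → Colouring n ks → Fin (length ks) → ℕ → Set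
MonoClique {n} c i k =
  Σ (Fin k → Fin n) λ f → Injective _≡_ _≡_ f × (∀ a b → a ≢ b → c (f a) (f b) ≡ i)

Arrows : ℕ → List ℕ → Set
Arrows n ks = (c : Colouring n ks) → SymmetricColouring {n} {ks} c →
  ∃[ i ] MonoClique {n} {ks} c i (lookup ks i)

IsRamsey : List ℕ → ℕ → Set
IsRamsey ks n = Arrows n ks × (∀ n′ → Arrows n′ ks → n ≤ n′)

DC : Set
DC = ∀ (s t : ℕ) (ks : List ℕ) → 3 ≤ s → s ≤ t → All (2 ≤_) ks →
  ∀ (a b : ℕ) → IsRamsey (s ∷ t ∷ ks) a → IsRamsey (pred s ∷ suc t ∷ ks) b →
  b ≤ a

-- Applying DC to the first two colours, with the colours permuted in between (which does not
-- change Ramsey numbers), turns the pattern (k, …, k) with 2r entries into (k-1, …, k-1, k+1, …, k+1)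
-- one pair at a time, without increasing the Ramsey number.  The Ramsey number of the latter is
-- larger than (R_r(k-1) - 1)(R_r(k+1) - 1): on pairs (x, y) of vertices of two extremal colourings,
-- colour an edge by the first colouring when the x's differ and by the second otherwise.
-- DC only speaks about Ramsey numbers that exist, so the argument also needs Ramsey's theorem;
-- since arrowing a finite pattern is decidable by exhaustive search, the least arrowing number
-- and the extremal colourings below it are then constructed explicitly.
module Submission where

open import Defs
open import Data.Nat using (ℕ; _≤_; _∸_; _*_; _+_; suc; pred)
open import Data.List using (replicate)

open import Level using (0ℓ)
open import Data.Nat using (zero; _<_; z≤n; s≤s; s≤s⁻¹; _≤?_; ≢-nonZero)
open import Data.Nat.Properties
  using (≤-refl; ≤-reflexive; ≤-trans; ≰⇒>; ≮⇒≥; <-irrefl; m≤n⇒m≤1+n; +-suc; *-suc; *-zeroʳ;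
         m+n≤o⇒m≤o; n≤0⇒n≡0; suc-pred; anyUpTo?)
open import Data.Nat.Induction using (<-rec; <-wellFounded)
open import Data.Fin using (Fin; zero; suc; _≟_; inject≤; lift; remQuot; combine)
open import Data.Fin.Properties using (any?; all?; ¬Fin0; suc-injective; inject≤-injective;
  lift-injective; combine-remQuot)
open import Data.Vec.Functional using (Vector; head; tail; updateAt; foldr)
import Data.Vec.Functional as Vector
open import Data.Vec.Functional.Properties using (updateAt-updates; updateAt-minimal)
open import Data.Vec.Functional.Relation.Binary.Pointwise using (Pointwise)
open import Data.List using (List; []; _∷_; _++_; length; lookup)
open import Data.List.Properties using (++-identityʳ)
open import Data.List.Relation.Unary.All using (All; []; _∷_)
open import Data.List.Relation.Unary.All.Properties using (++⁺; replicate⁺)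
import Data.List.Relation.Binary.Permutation.Setoid as Permutation
import Data.List.Relation.Binary.Permutation.Setoid.Properties as PermutationProperties
open import Data.Product using (Σ; ∃; _×_; _,_; proj₁; proj₂; uncurry)
import Data.Product as Product
open import Data.Sum using (_⊎_; inj₁; inj₂; [_,_]′)
import Data.Sum as Sum
open import Data.Sum.Properties using (inj₁-injective; inj₂-injective)
open import Data.Empty using (⊥-elim)
open import Function using (_∘_; _↔_; Inverse; mk↔ₛ′)
open import Function.Definitions using (Injective)
open import Induction.WellFounded using (Acc; acc)
open import Relation.Binary using (Rel; Reflexive; _Respects_)
open import Relation.Binary.PropositionalEquality
  using (_≡_; _≢_; refl; sym; trans; cong; cong₂; subst; setoid)
open import Relation.Nullary using (¬_; Dec; yes; no; contradiction; map′; ¬?; _×-dec_; _→-dec_)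
open import Relation.Unary using (Pred; Decidable)

open Permutation (setoid ℕ) using (_↭_; ↭-sym; ↭-trans; onIndices)
open PermutationProperties (setoid ℕ) using (onIndices-lookup; shifts; ↭-shift; ++⁺ˡ)

private
  variable
    C D : Set
    m n n′ k d : ℕ

-- For a list ks of sizes, Arrows n ks is by definition n ⟶ lookup ks.

EdgeColouring : ℕ → Set → Set
EdgeColouring n C = Fin n → Fin n → C

IsSymmetric : EdgeColouring n C → Set
IsSymmetric c = ∀ x y → c x y ≡ c y x

Clique : EdgeColouring n C → C → ℕ → Set
Clique {n} c i k = Σ (Fin k → Fin n) λ f → Injective _≡_ _≡_ f × (∀ a b → a ≢ b → c (f a) (f b) ≡ i)

_⟶_ : ℕ → (C → ℕ) → Set
_⟶_ {C} n ks = (c : EdgeColouring n C) → IsSymmetric c → ∃ λ i → Clique c i (ks i)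

AvoidingColouring : ℕ → (C → ℕ) → Set
AvoidingColouring {C} n ks =
  Σ (EdgeColouring n C) λ c → IsSymmetric c × (∀ i → ¬ Clique c i (ks i))

Avoiding⇒¬⟶ : {ks : C → ℕ} → AvoidingColouring n ks → ¬ (n ⟶ ks)
Avoiding⇒¬⟶ (c , c-sym , no-clique) n⟶ks = let (i , q) = n⟶ks c c-sym in no-clique i q

Clique-empty : (c : EdgeColouring n C) (i : C) → Clique c i 0
Clique-empty c i = (λ ()) , (λ {x} → ⊥-elim (¬Fin0 x)) , λ ()

Clique-resp : {c c′ : EdgeColouring n C} {i : C} → (∀ x y → c x y ≡ c′ x y) →
  Clique c i k → Clique c′ i k
Clique-resp c≗c′ (f , f-inj , f-col) = f , f-inj , λ a b a≢b → trans (sym (c≗c′ _ _)) (f-col a b a≢b)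

Clique-map : (c : EdgeColouring n C) {i : C} (e : Fin n′ → Fin n) → Injective _≡_ _≡_ e →
  Clique (λ x y → c (e x) (e y)) i k → Clique c i k
Clique-map c e e-inj (f , f-inj , f-col) = e ∘ f , (λ eq → f-inj (e-inj eq)) , f-col

Clique-extend : {c : EdgeColouring (suc n) C} {i : C} → IsSymmetric c →
  (q : Clique (λ x y → c (suc x) (suc y)) i k) → (∀ a → c zero (suc (proj₁ q a)) ≡ i) →
  Clique c i (suc k)
Clique-extend {c = c} {i} c-sym (f , f-inj , f-col) zero-col = lift 1 f , lift-injective f f-inj 1 , col
  where
  col : ∀ a b → a ≢ b → c (lift 1 f a) (lift 1 f b) ≡ i
  col zero    zero    a≢b = contradiction refl a≢b
  col zero    (suc b) _   = zero-col b
  col (suc a) zero    _   = trans (c-sym _ _) (zero-col a)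
  col (suc a) (suc b) a≢b = f-col a b (a≢b ∘ cong suc)

⟶-mono : {ks : C → ℕ} → m ≤ n → m ⟶ ks → n ⟶ ks
⟶-mono m≤n m⟶ks c c-sym =
  Product.map₂ (Clique-map c ι (inject≤-injective m≤n m≤n _ _)) (m⟶ks (λ x y → c (ι x) (ι y)) (λ _ _ → c-sym _ _))
  where
  ι = λ x → inject≤ x m≤n

Clique-recolour : (c : EdgeColouring n C) (g : C → D) (h : D → C) → (∀ x → h (g x) ≡ x) → {j : D} →
  Clique (λ x y → g (c x y)) j k → Clique c (h j) k
Clique-recolour c g h h∘g≗id (f , f-inj , f-col) =
  f , f-inj , λ a b a≢b → trans (sym (h∘g≗id _)) (cong h (f-col a b a≢b))

⟶-transport : {ks : C → ℕ} {ls : D → ℕ} (ρ : C ↔ D) → (∀ i → ls (Inverse.to ρ i) ≡ ks i) →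
  n ⟶ ks → n ⟶ ls
⟶-transport ρ ls∘to≗ks n⟶ks c c-sym =
  let (i , q) = n⟶ks (λ x y → from (c x y)) (λ x y → cong from (c-sym x y)) in
  to i , subst (Clique c (to i)) (sym (ls∘to≗ks i)) (Clique-recolour c from to strictlyInverseˡ q)
  where open Inverse ρ

Avoiding-transport : {ks : C → ℕ} {ls : D → ℕ} (ρ : C ↔ D) → (∀ i → ls (Inverse.to ρ i) ≡ ks i) →
  AvoidingColouring n ks → AvoidingColouring n ls
Avoiding-transport {ks = ks} {ls} ρ ls∘to≗ks (c , c-sym , no-clique) =
  (λ x y → to (c x y)) , (λ x y → cong to (c-sym x y)) ,
  λ j q → no-clique (from j) (subst (Clique c (from j)) (size j) (Clique-recolour c to from strictlyInverseʳ q))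
  where
  open Inverse ρ
  size : ∀ j → ls j ≡ ks (from j)
  size j = trans (cong ls (sym (strictlyInverseˡ j))) (ls∘to≗ks (from j))

-- Exhaustive search over finite function spaces

Searchable : (A : Set) → Rel A 0ℓ → Set₁
Searchable A _≈_ = ∀ {P : Pred A 0ℓ} → P Respects _≈_ → Decidable P → Dec (∃ P)

Fin-searchable : Searchable (Fin n) _≡_
Fin-searchable _ = any?

Vector-searchable : {A : Set} {_≈_ : Rel A 0ℓ} → Reflexive _≈_ → Searchable A _≈_ →
  ∀ k → Searchable (Vector A k) (Pointwise _≈_)
Vector-searchable refl≈ search zero P-resp P? =
  map′ (λ p → _ , p) (λ (f , p) → P-resp (λ ()) p) (P? (λ ()))
Vector-searchable refl≈ search (suc k) P-resp P? =
  map′ (λ (a , g , p) → a Vector.∷ g , p)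
       (λ (f , p) → head f , tail f , P-resp (λ { zero → refl≈ ; (suc _) → refl≈ }) p)
       (search (λ a≈b (g , p) → g , P-resp (λ { zero → a≈b ; (suc _) → refl≈ }) p)
               (λ a → Vector-searchable refl≈ search k
                        (λ g≈h → P-resp λ { zero → refl≈ ; (suc i) → g≈h i })
                        (λ g → P? (a Vector.∷ g))))

injective? : (f : Fin k → Fin n) → Dec (Injective _≡_ _≡_ f)
injective? f =
  map′ (λ inj → inj _ _) (λ inj _ _ → inj) (all? λ a → all? λ b → (f a ≟ f b) →-dec (a ≟ b))

clique? : (c : EdgeColouring n (Fin m)) (i : Fin m) (k : ℕ) → Dec (Clique c i k)
clique? c i k = Vector-searchable refl Fin-searchable k resp
  (λ f → injective? f ×-dec (all? λ a → all? λ b → ¬? (a ≟ b) →-dec (c (f a) (f b) ≟ i)))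
  where
  resp : ∀ {f g} → Pointwise _≡_ f g → _ → _
  resp f≗g (f-inj , f-col) =
    (λ {a} {b} eq → f-inj (trans (f≗g a) (trans eq (sym (f≗g b))))) ,
    (λ a b a≢b → trans (cong₂ c (sym (f≗g a)) (sym (f≗g b))) (f-col a b a≢b))

⟶-or-avoiding : ∀ n (ks : Fin m → ℕ) → n ⟶ ks ⊎ AvoidingColouring n ks
⟶-or-avoiding n ks with Vector-searchable (λ _ → refl) (Vector-searchable refl Fin-searchable n) n
                          resp (λ c → symmetric? c ×-dec all? λ i → ¬? (clique? c i (ks i)))
  where
  symmetric? : (c : EdgeColouring n _) → Dec (IsSymmetric c)
  symmetric? c = all? λ x → all? λ y → c x y ≟ c y x
  resp : ∀ {c c′} → Pointwise (Pointwise _≡_) c c′ → _ → _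
  resp c≗c′ (c-sym , no-clique) =
    (λ x y → trans (sym (c≗c′ x y)) (trans (c-sym x y) (c≗c′ y x))) ,
    (λ i q → no-clique i (Clique-resp (λ x y → sym (c≗c′ x y)) q))
... | yes avoiding = inj₂ avoiding
... | no ¬avoiding = inj₁ arrows
  where
  arrows : n ⟶ ks
  arrows c c-sym with any? (λ i → clique? c i (ks i))
  ... | yes clique = clique
  ... | no ¬clique = contradiction (c , c-sym , λ i q → ¬clique (i , q)) ¬avoiding

⟶? : ∀ n (ks : Fin m → ℕ) → Dec (n ⟶ ks)
⟶? n ks = [ yes , no ∘ Avoiding⇒¬⟶ ]′ (⟶-or-avoiding n ks)

least-witness : {P : Pred ℕ 0ℓ} → Decidable P → ∀ n → P n → ∃ λ m → P m × (∀ n′ → P n′ → m ≤ n′)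
least-witness {P} P? = <-rec (λ n → P n → _) search
  where
  search : ∀ n → (∀ {m} → m < n → P m → _) → P n → _
  search n smaller Pn with anyUpTo? P? n
  ... | yes (m , m<n , Pm) = smaller m<n Pm
  ... | no ∄smaller = n , Pn , λ n′ Pn′ → ≮⇒≥ λ n′<n → ∄smaller (n′ , n′<n , Pn′)

-- Ramsey's theorem

sum : Vector ℕ m → ℕ
sum = foldr _+_ 0

sum-updateAt-pred : (ks : Vector ℕ m) (i : Fin m) → ks i ≢ 0 → suc (sum (updateAt ks i pred)) ≡ sum ks
sum-updateAt-pred ks zero    ki≢0 = cong (_+ sum (tail ks)) (suc-pred (ks zero) {{≢-nonZero ki≢0}})
sum-updateAt-pred ks (suc i) ki≢0 =
  trans (sym (+-suc (head ks) _)) (cong (head ks +_) (sum-updateAt-pred (tail ks) i ki≢0))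

updateAt-pred-updates : (ks : Vector ℕ m) (i : Fin m) → ks i ≢ 0 → suc (updateAt ks i pred i) ≡ ks i
updateAt-pred-updates ks i ki≢0 =
  trans (cong suc (updateAt-updates i ks)) (suc-pred (ks i) {{≢-nonZero ki≢0}})

Fibre : (Fin d → C) → C → ℕ → Set
Fibre {d} h i k = Σ (Fin k → Fin d) λ g → Injective _≡_ _≡_ g × (∀ a → h (g a) ≡ i)

Fibre-empty : (h : Fin d → C) (i : C) → Fibre h i 0
Fibre-empty h i = (λ ()) , (λ {x} → ⊥-elim (¬Fin0 x)) , λ ()

pigeonhole : (N : Vector ℕ (suc m)) (h : Fin d → Fin (suc m)) → sum N ≤ d → ∃ λ i → Fibre h i (N i)
pigeonhole {d = zero} N h ΣN≤0 =
  zero , subst (Fibre h zero) (sym (n≤0⇒n≡0 (m+n≤o⇒m≤o (N zero) ΣN≤0))) (Fibre-empty h zero)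
pigeonhole {d = suc d} N h ΣN≤1+d with N (h zero) Data.Nat.≟ 0
... | yes Nj≡0 = h zero , subst (Fibre h (h zero)) (sym Nj≡0) (Fibre-empty h (h zero))
... | no Nj≢0
  with pigeonhole (updateAt N (h zero) pred) (h ∘ suc)
         (s≤s⁻¹ (subst (_≤ suc d) (sym (sum-updateAt-pred N (h zero) Nj≢0)) ΣN≤1+d))
...   | i , g , g-inj , g-fib with i ≟ h zero
...     | no i≢j =
  i , subst (Fibre h i) (updateAt-minimal i (h zero) N i≢j) (suc ∘ g , (λ eq → g-inj (suc-injective eq)) , g-fib)
...     | yes refl =
  i , subst (Fibre h i) (updateAt-pred-updates N i Nj≢0)
        (lift 1 g , lift-injective g g-inj 1 , λ { zero → refl ; (suc a) → g-fib a })

-- Vertex 0 has Σ N_i further neighbours, so some colour i reaches N_i of them, and among those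
-- there is either a K_{k_j} in colour j ≠ i or a K_{k_i - 1} in colour i, which vertex 0 extends.
⟶-recurrence : (ks N : Vector ℕ (suc m)) → (∀ i → ks i ≢ 0) → (∀ i → N i ⟶ updateAt ks i pred) →
  suc (sum N) ⟶ ks
⟶-recurrence ks N ks≢0 N⟶ c c-sym with pigeonhole N (λ x → c zero (suc x)) ≤-refl
... | i , g , g-inj , g-fib with N⟶ i (λ a b → c (suc (g a)) (suc (g b))) (λ _ _ → c-sym _ _)
...   | j , q with j ≟ i
...     | no j≢i =
  j , subst (Clique c j) (updateAt-minimal j i ks j≢i) (Clique-map c (suc ∘ g) (λ eq → g-inj (suc-injective eq)) q)
...     | yes refl =
  j , subst (Clique c j) (updateAt-pred-updates ks j (ks≢0 j))
        (Clique-extend c-sym (Clique-map (λ x y → c (suc x) (suc y)) g g-inj q) (λ a → g-fib (proj₁ q a)))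

ramsey-acc : (ks : Vector ℕ m) → Acc _<_ (sum ks) → ∃ (_⟶ ks)
-- With no colours not even K_1 can be coloured, since the encoding also colours the diagonal.
ramsey-acc {zero} ks _ = 1 , λ c _ → contradiction (c zero zero) ¬Fin0
ramsey-acc {suc m} ks (acc smaller) with any? (λ i → ks i Data.Nat.≟ 0)
... | yes (i , ki≡0) = 0 , λ c _ → i , subst (Clique c i) (sym ki≡0) (Clique-empty c i)
... | no ∄zero = suc (sum (proj₁ ∘ R)) , ⟶-recurrence ks (proj₁ ∘ R) ks≢0 (proj₂ ∘ R)
  where
  ks≢0 : ∀ i → ks i ≢ 0
  ks≢0 i ki≡0 = ∄zero (i , ki≡0)
  R : ∀ i → ∃ (_⟶ updateAt ks i pred)
  R i = ramsey-acc (updateAt ks i pred) (smaller (≤-reflexive (sum-updateAt-pred ks i (ks≢0 i))))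

ramsey : (ks : Vector ℕ m) → ∃ (_⟶ ks)
ramsey ks = ramsey-acc ks (<-wellFounded (sum ks))

ramsey-number : ∀ ks → ∃ (IsRamsey ks)
ramsey-number ks = let (n , n⟶ks) = ramsey (lookup ks) in least-witness (λ n → ⟶? n (lookup ks)) n n⟶ks

below-Ramsey-avoiding : ∀ {ks} → IsRamsey ks (suc n) → AvoidingColouring n (lookup ks)
below-Ramsey-avoiding {n} {ks} (_ , minimal) with ⟶-or-avoiding n (lookup ks)
... | inj₁ n⟶ks = contradiction (minimal n n⟶ks) (<-irrefl refl)
... | inj₂ avoiding = avoiding

avoiding-<-Ramsey : ∀ {ks y} → IsRamsey ks y → AvoidingColouring n (lookup ks) → n < y
avoiding-<-Ramsey {n} {y = y} (y⟶ks , _) avoiding with y ≤? n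
... | yes y≤n = contradiction (⟶-mono y≤n y⟶ks) (Avoiding⇒¬⟶ avoiding)
... | no y≰n = ≰⇒> y≰n

-- Products of colourings

_⊠_ : EdgeColouring m C → EdgeColouring n D → Fin m × Fin n → Fin m × Fin n → C ⊎ D
(c ⊠ d) (x , y) (x′ , y′) with x ≟ x′
... | yes _ = inj₂ (d y y′)
... | no  _ = inj₁ (c x x′)

⊠-symmetric : {c : EdgeColouring m C} {d : EdgeColouring n D} → IsSymmetric c → IsSymmetric d →
  ∀ p q → (c ⊠ d) p q ≡ (c ⊠ d) q p
⊠-symmetric c-sym d-sym (x , y) (x′ , y′) with x ≟ x′ | x′ ≟ x
... | yes _    | yes _    = cong inj₂ (d-sym y y′)
... | no  _    | no  _    = cong inj₁ (c-sym x x′)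
... | yes x≡x′ | no  x′≢x = contradiction (sym x≡x′) x′≢x
... | no  x≢x′ | yes x′≡x = contradiction (sym x′≡x) x≢x′

⊠≡inj₁ : {c : EdgeColouring m C} {d : EdgeColouring n D} {i : C} → ∀ x y x′ y′ →
  (c ⊠ d) (x , y) (x′ , y′) ≡ inj₁ i → x ≢ x′ × c x x′ ≡ i
⊠≡inj₁ x y x′ y′ eq with x ≟ x′
⊠≡inj₁ x y x′ y′ () | yes _
... | no x≢x′ = x≢x′ , inj₁-injective eq

⊠≡inj₂ : {c : EdgeColouring m C} {d : EdgeColouring n D} {j : D} → ∀ x y x′ y′ →
  (c ⊠ d) (x , y) (x′ , y′) ≡ inj₂ j → x ≡ x′ × d y y′ ≡ j
⊠≡inj₂ x y x′ y′ eq with x ≟ x′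
⊠≡inj₂ x y x′ y′ () | no _
... | yes x≡x′ = x≡x′ , inj₂-injective eq

remQuot-injective : ∀ n → Injective _≡_ _≡_ (remQuot {m} n)
remQuot-injective {m} n {u} {v} eq =
  trans (sym (combine-remQuot {m} n u)) (trans (cong (uncurry combine) eq) (combine-remQuot {m} n v))

_⊗_ : EdgeColouring m C → EdgeColouring n D → EdgeColouring (m * n) (C ⊎ D)
_⊗_ {m = m} {n = n} c d u v = (c ⊠ d) (remQuot {m} n u) (remQuot n v)

⊗-clique₁ : (c : EdgeColouring m C) (d : EdgeColouring n D) {i : C} → Clique (c ⊗ d) (inj₁ i) k → Clique c i k
⊗-clique₁ {m = m} {n = n} c d (f , f-inj , f-col) = proj₁ ∘ π ∘ f , inj , λ a b a≢b → proj₂ (split a b a≢b)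
  where
  π = remQuot {m} n
  split = λ a b a≢b → ⊠≡inj₁ {c = c} {d} _ _ _ _ (f-col a b a≢b)
  inj : Injective _≡_ _≡_ (proj₁ ∘ π ∘ f)
  inj {a} {b} eq with a ≟ b
  ... | yes a≡b = a≡b
  ... | no a≢b = contradiction eq (proj₁ (split a b a≢b))

⊗-clique₂ : (c : EdgeColouring m C) (d : EdgeColouring n D) {j : D} → Clique (c ⊗ d) (inj₂ j) k → Clique d j k
⊗-clique₂ {m = m} {n = n} c d (f , f-inj , f-col) = proj₂ ∘ π ∘ f , inj , λ a b a≢b → proj₂ (split a b a≢b)
  where
  π = remQuot {m} n
  split = λ a b a≢b → ⊠≡inj₂ {c = c} {d} _ _ _ _ (f-col a b a≢b)
  inj : Injective _≡_ _≡_ (proj₂ ∘ π ∘ f)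
  inj {a} {b} eq with a ≟ b
  ... | yes a≡b = a≡b
  ... | no a≢b = f-inj (remQuot-injective n (cong₂ _,_ (proj₁ (split a b a≢b)) eq))

Avoiding-* : {ks : C → ℕ} {ls : D → ℕ} → AvoidingColouring m ks → AvoidingColouring n ls →
  AvoidingColouring (m * n) [ ks , ls ]′
Avoiding-* {m = m} {n = n} (c , c-sym , no-c-clique) (d , d-sym , no-d-clique) =
  c ⊗ d , (λ u v → ⊠-symmetric c-sym d-sym (remQuot {m} n u) (remQuot n v)) , λ where
    (inj₁ i) q → no-c-clique i (⊗-clique₁ c d q)
    (inj₂ j) q → no-d-clique j (⊗-clique₂ c d q)

module _ {A : Set} where

  ++-index : (xs ys : List A) → Fin (length xs) ⊎ Fin (length ys) → Fin (length (xs ++ ys))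
  ++-index []       ys (inj₂ j)       = j
  ++-index (x ∷ xs) ys (inj₁ zero)    = zero
  ++-index (x ∷ xs) ys (inj₁ (suc i)) = suc (++-index xs ys (inj₁ i))
  ++-index (x ∷ xs) ys (inj₂ j)       = suc (++-index xs ys (inj₂ j))

  ++-index⁻¹ : (xs ys : List A) → Fin (length (xs ++ ys)) → Fin (length xs) ⊎ Fin (length ys)
  ++-index⁻¹ []       ys j       = inj₂ j
  ++-index⁻¹ (x ∷ xs) ys zero    = inj₁ zero
  ++-index⁻¹ (x ∷ xs) ys (suc i) = Sum.map₁ suc (++-index⁻¹ xs ys i)

  ++-index-suc : ∀ x (xs ys : List A) s → ++-index (x ∷ xs) ys (Sum.map₁ suc s) ≡ suc (++-index xs ys s)
  ++-index-suc x xs ys (inj₁ i) = refl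
  ++-index-suc x xs ys (inj₂ j) = refl

  ++-index-++-index⁻¹ : (xs ys : List A) → ∀ i → ++-index xs ys (++-index⁻¹ xs ys i) ≡ i
  ++-index-++-index⁻¹ []       ys j       = refl
  ++-index-++-index⁻¹ (x ∷ xs) ys zero    = refl
  ++-index-++-index⁻¹ (x ∷ xs) ys (suc i) =
    trans (++-index-suc x xs ys (++-index⁻¹ xs ys i)) (cong suc (++-index-++-index⁻¹ xs ys i))

  ++-index⁻¹-++-index : (xs ys : List A) → ∀ s → ++-index⁻¹ xs ys (++-index xs ys s) ≡ s
  ++-index⁻¹-++-index []       ys (inj₂ j)       = refl
  ++-index⁻¹-++-index (x ∷ xs) ys (inj₁ zero)    = refl
  ++-index⁻¹-++-index (x ∷ xs) ys (inj₁ (suc i)) = cong (Sum.map₁ suc) (++-index⁻¹-++-index xs ys (inj₁ i))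
  ++-index⁻¹-++-index (x ∷ xs) ys (inj₂ j)       = cong (Sum.map₁ suc) (++-index⁻¹-++-index xs ys (inj₂ j))

  ++-indices : (xs ys : List A) → (Fin (length xs) ⊎ Fin (length ys)) ↔ Fin (length (xs ++ ys))
  ++-indices xs ys =
    mk↔ₛ′ (++-index xs ys) (++-index⁻¹ xs ys) (++-index-++-index⁻¹ xs ys) (++-index⁻¹-++-index xs ys)

  lookup-++-index : (xs ys : List A) → ∀ s → lookup (xs ++ ys) (++-index xs ys s) ≡ [ lookup xs , lookup ys ]′ s
  lookup-++-index []       ys (inj₂ j)       = refl
  lookup-++-index (x ∷ xs) ys (inj₁ zero)    = refl
  lookup-++-index (x ∷ xs) ys (inj₁ (suc i)) = lookup-++-index xs ys (inj₁ i)
  lookup-++-index (x ∷ xs) ys (inj₂ j)       = lookup-++-index xs ys (inj₂ j)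

-- Ramsey numbers of lists of sizes

Arrows-resp-↭ : ∀ {ks ls} → ks ↭ ls → Arrows n ks → Arrows n ls
Arrows-resp-↭ p = ⟶-transport (onIndices p) (λ i → sym (onIndices-lookup p i))

IsRamsey-resp-↭ : ∀ {ks ls} → ks ↭ ls → IsRamsey ks n → IsRamsey ls n
IsRamsey-resp-↭ p (n⟶ks , minimal) =
  Arrows-resp-↭ p n⟶ks , λ n′ n′⟶ls → minimal n′ (Arrows-resp-↭ (↭-sym p) n′⟶ls)

Ramsey-++-supermultiplicative : ∀ {ks ls p q y} → IsRamsey ks (suc p) → IsRamsey ls (suc q) →
  IsRamsey (ks ++ ls) y → p * q < y
Ramsey-++-supermultiplicative {ks} {ls} Rks Rls Rks++ls =
  avoiding-<-Ramsey {ks = ks ++ ls} Rks++ls (Avoiding-transport (++-indices ks ls) (lookup-++-index ks ls)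
    (Avoiding-* (below-Ramsey-avoiding {ks = ks} Rks) (below-Ramsey-avoiding {ks = ls} Rls)))

replicate-2*-suc : ∀ r {A : Set} (x : A) → replicate (2 * suc r) x ≡ x ∷ x ∷ replicate (2 * r) x
replicate-2*-suc r x = cong (λ l → replicate l x) (*-suc 2 r)

DC⇒Ramsey-spread-≤ : DC → ∀ {k} → 3 ≤ k → ∀ r {ks} → All (2 ≤_) ks → ∀ {a b} →
  IsRamsey (replicate (2 * r) k ++ ks) a →
  IsRamsey (replicate r (pred k) ++ replicate r (suc k) ++ ks) b → b ≤ a
DC⇒Ramsey-spread-≤ dc 3≤k zero ks≥2 Ra Rb = proj₂ Rb _ (proj₁ Ra)
DC⇒Ramsey-spread-≤ dc {k} 3≤k@(s≤s 2≤k-1) (suc r) {ks} ks≥2 {a} {b} Ra Rb =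
  ≤-trans b≤z z≤a
  where
  K = replicate (2 * r) k
  U = replicate r (pred k)
  V = replicate r (suc k)
  R = ramsey-number (pred k ∷ suc k ∷ K ++ ks)
  2≤k : 2 ≤ k
  2≤k = m≤n⇒m≤1+n 2≤k-1
  z≤a : proj₁ R ≤ a
  z≤a = dc k k (K ++ ks) 3≤k ≤-refl (++⁺ (replicate⁺ (2 * r) 2≤k) ks≥2) a (proj₁ R)
    (subst (λ xs → IsRamsey (xs ++ ks) a) (replicate-2*-suc r k) Ra) (proj₂ R)
  regroup : U ++ V ++ pred k ∷ suc k ∷ ks ↭ (pred k ∷ U) ++ (suc k ∷ V) ++ ks
  regroup = ↭-trans (++⁺ˡ U (shifts V (pred k ∷ suc k ∷ []))) (↭-shift U (suc k ∷ V ++ ks))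
  b≤z : b ≤ proj₁ R
  b≤z = DC⇒Ramsey-spread-≤ dc 3≤k r (2≤k-1 ∷ m≤n⇒m≤1+n 2≤k ∷ ks≥2)
    (IsRamsey-resp-↭ (shifts (pred k ∷ suc k ∷ []) K) (proj₂ R)) (IsRamsey-resp-↭ (↭-sym regroup) Rb)

<⇒≤∸1 : ∀ {m n} → m < n → m ≤ n ∸ 1
<⇒≤∸1 (s≤s m≤n) = m≤n

lemma1 : DC → ∀ (k r : ℕ) → 3 ≤ k → 1 ≤ r →
    ∀ (a b c : ℕ) →
    IsRamsey (replicate (2 * r) k) a →
    IsRamsey (replicate r (pred k)) b →
    IsRamsey (replicate r (suc k)) c →
    (b ∸ 1) * (c ∸ 1) ≤ a ∸ 1
-- The bound holds for r = 0 as well.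
lemma1 dc k r 3≤k _ a zero    c       Ra Rb Rc = z≤n
lemma1 dc k r 3≤k _ a (suc p) zero    Ra Rb Rc = subst (_≤ a ∸ 1) (sym (*-zeroʳ p)) z≤n
lemma1 dc k r 3≤k _ a (suc p) (suc q) Ra Rb Rc =
  <⇒≤∸1 (≤-trans (Ramsey-++-supermultiplicative {U} {V} Rb Rc (proj₂ R)) y≤a)
  where
  U = replicate r (pred k)
  V = replicate r (suc k)
  R = ramsey-number (U ++ V)
  y≤a : proj₁ R ≤ a
  y≤a = DC⇒Ramsey-spread-≤ dc 3≤k r []
    (subst (λ xs → IsRamsey xs a) (sym (++-identityʳ (replicate (2 * r) k))) Ra)
    (subst (λ xs → IsRamsey (U ++ xs) (proj₁ R)) (sym (++-identityʳ V)) (proj₂ R))
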